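{- Let $(G,w)$ be a weighted $\{2,3\}$-intersection graph arising from a hereditary $\{2,3\}$-collection $(V,U)$. Then: (i) $G$ contains no 4-claw, and every 3-claw in $G$ has a center of weight 2; (ii) for every weight-2 vertex $v$, every vertex $x\neq v$ that is adjacent to some vertex of $K_4^v$ is adjacent to $v$ (that is, $v$ dominates the neighborhood of $K_4^v$); (iii) every single neighbor $u$ of a weight-2 vertex $v$ is adjacent to exactly two of the weight-1 vertices of $K_4^v$.
   Context: A pair $(V,U)$ is a hereditary $\{2,3\}$-collection if $V$ is a finite set and $U=\{U_v : v\in V\}$ is a collection of sets, each of size 2 or 3, such that for each $v\in V$ with $U_v=\{a,b,c\}$ there are elements $v_a,v_b,v_c\in V$ with $U_{v_a}=\{b,c\}$, $U_{v_b}=\{a,c\}$, $U_{v_c}=\{a,b\}$. The $\{2,3\}$-intersection graph of $(V,U)$ is the multigraph $G$ with vertex set $V$ having $|U_x\cap U_y|$ parallel edges between any two distinct vertices $x,y$ (so $x,y$ are adjacent iff $U_x\cap U_y\neq\emptyset$); it is weighted with $w_v=|U_v|-1$ for each $v$. Two adjacent vertices $x,y$ are single neighbors if $|U_x\cap U_y|=1$. For a weight-2 vertex $v$ with $U_v=\{a,b,c\}$, $K_4^v$ denotes the subgraph induced by $v,v_a,v_b,v_c$ (with $v_a,v_b,v_c$ as in the definition of hereditary collection); it is a $K_4$. A $d$-claw is an induced subgraph $C$ consisting of an independent set $T_C$ of $d$ vertices and a center vertex adjacent to all vertices of $T_C$. -}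

module Defs where

open import Data.Nat using (ℕ; _∸_)
open import Data.Fin using (Fin)
open import Data.Fin.Subset using (Subset; _∩_; _∪_; ⁅_⁆; ∣_∣; Nonempty)
open import Data.Product using (_×_; Σ; ∃; ∃-syntax; _,_)
open import Data.Sum using (_⊎_)
open import Relation.Binary.PropositionalEquality using (_≡_; _≢_)
open import Relation.Nullary using (¬_)

Distinct3 : ∀ {m} → Fin m → Fin m → Fin m → Set
Distinct3 a b c = a ≢ b × a ≢ c × b ≢ c

Triple : ∀ {m} → Fin m → Fin m → Fin m → Subset m
Triple a b c = ⁅ a ⁆ ∪ ⁅ b ⁆ ∪ ⁅ c ⁆

Pair : ∀ {m} → Fin m → Fin m → Subset m
Pair a b = ⁅ a ⁆ ∪ ⁅ b ⁆

ExactlyTwo : Set → Set → Set → Set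
ExactlyTwo P Q R = (P × Q × ¬ R) ⊎ (P × ¬ Q × R) ⊎ (¬ P × Q × R)

record Hereditary23 : Set where
  field
    n : ℕ
    m : ℕ
    U : Fin n → Subset m
    size23 : ∀ v → ∣ U v ∣ ≡ 2 ⊎ ∣ U v ∣ ≡ 3
    hereditary : ∀ v a b c → Distinct3 a b c → U v ≡ Triple a b c →
      ∃[ va ] ∃[ vb ] ∃[ vc ]
        (U va ≡ Pair b c × U vb ≡ Pair a c × U vc ≡ Pair a b)

module _ (H : Hereditary23) where
  open Hereditary23 H

  w : Fin n → ℕ
  w v = ∣ U v ∣ ∸ 1

  -- number of parallel edges between x and y in the {2,3}-intersection graph
  edges : Fin n → Fin n → ℕ
  edges x y = ∣ U x ∩ U y ∣

  Adj : Fin n → Fin n → Set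
  Adj x y = x ≢ y × Nonempty (U x ∩ U y)

  SingleNeighbors : Fin n → Fin n → Set
  SingleNeighbors x y = Adj x y × edges x y ≡ 1

  IsClaw : (d : ℕ) → Fin n → (Fin d → Fin n) → Set
  IsClaw d c T =
    (∀ i j → T i ≡ T j → i ≡ j) ×
    (∀ i j → ¬ Adj (T i) (T j)) ×
    (∀ i → Adj c (T i))

  -- (va, vb, vc) are the weight-1 vertices of K_4^v for U_v = {a,b,c}
  IsK4 : Fin n → Fin m → Fin m → Fin m → Fin n → Fin n → Fin n → Set
  IsK4 v a b c va vb vc =
    Distinct3 a b c × U v ≡ Triple a b c ×
    U va ≡ Pair b c × U vb ≡ Pair a c × U vc ≡ Pair a b

-- A vertex set has at most three elements, and leaves of a claw hit pairwise
-- different elements of the centre's set (two leaves sharing an element would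
-- be adjacent), so claws have at most |U_c| ≤ 3 leaves. Every weight-1 vertex
-- of K₄^v has its pair inside U_v, hence its neighbours meet U_v. A single
-- neighbour u of v meets U_v = {a,b,c} in exactly one element e, and u is
-- adjacent to a pair {p,q} ⊆ U_v precisely when e ∈ {p,q}: this holds for
-- exactly two of the pairs {b,c}, {a,c}, {a,b}.
module Submission where

open import Defs
open import Data.Nat using (ℕ; zero; suc; _≤_; z≤n; s≤s; _∸_)
open import Data.Nat.Properties using (≤-trans; <-irrefl)
open import Data.Fin using (Fin; zero; suc; _≟_)
open import Data.Fin.Properties using (suc-injective; 0≢1+n)
open import Data.Fin.Subset using (Subset; _∈_; _∉_; _⊆_; _∩_; ∣_∣; _-_)
open import Data.Fin.Subset.Properties
open import Data.Product using (_×_; _,_; proj₁; proj₂)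
open import Data.Sum using (_⊎_; inj₁; inj₂; [_,_])
open import Data.Empty using (⊥-elim)
open import Function using (_∘_)
open import Function.Bundles using (_⇔_; mk⇔; Equivalence)
open import Function.Definitions using (Injective)
import Function.Properties.Equivalence as ⇔
open import Relation.Binary.PropositionalEquality using (_≡_; _≢_; refl; sym; subst; cong)
open import Relation.Nullary using (¬_; yes; no)

open Equivalence using (to; from)

module _ {m : ℕ} where

  injection⇒≤∣p∣ : ∀ {k} (f : Fin k → Fin m) {p : Subset m} →
                   Injective _≡_ _≡_ f → (∀ i → f i ∈ p) → k ≤ ∣ p ∣
  injection⇒≤∣p∣ {zero}  f f-inj f∈p = z≤n
  injection⇒≤∣p∣ {suc k} f {p} f-inj f∈p =
    ≤-trans (s≤s (injection⇒≤∣p∣ (f ∘ suc) (suc-injective ∘ f-inj) f∘suc∈p-f0))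
            (x∈p⇒∣p-x∣<∣p∣ (f∈p zero))
    where
      f∘suc∈p-f0 : ∀ i → f (suc i) ∈ p - f zero
      f∘suc∈p-f0 i = x∈p∧x≢y⇒x∈p-y (f∈p (suc i)) (0≢1+n ∘ sym ∘ f-inj)

  distinct⇒2≤∣p∣ : ∀ {x y} {p : Subset m} → x ∈ p → y ∈ p → x ≢ y → 2 ≤ ∣ p ∣
  distinct⇒2≤∣p∣ x∈p y∈p x≢y =
    ≤-trans (s≤s (≤-trans (s≤s z≤n) (x∈p⇒∣p-x∣<∣p∣ y∈p-x))) (x∈p⇒∣p-x∣<∣p∣ x∈p)
    where y∈p-x = x∈p∧x≢y⇒x∈p-y y∈p (x≢y ∘ sym)

  ∣p∣≡1⇒unique : ∀ {x y} {p : Subset m} → ∣ p ∣ ≡ 1 → x ∈ p → y ∈ p → x ≡ y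
  ∣p∣≡1⇒unique {x} {y} ∣p∣≡1 x∈p y∈p with x ≟ y
  ... | yes x≡y = x≡y
  ... | no  x≢y = ⊥-elim (<-irrefl refl (subst (2 ≤_) ∣p∣≡1 (distinct⇒2≤∣p∣ x∈p y∈p x≢y)))

  ∈-Pair⁻ : ∀ {a b e : Fin m} → e ∈ Pair a b → e ≡ a ⊎ e ≡ b
  ∈-Pair⁻ {a} {b} e∈ with x∈p∪q⁻ _ _ e∈
  ... | inj₁ e∈a = inj₁ (x∈⁅y⁆⇒x≡y a e∈a)
  ... | inj₂ e∈b = inj₂ (x∈⁅y⁆⇒x≡y b e∈b)

  ∈-Pairˡ : ∀ {a b : Fin m} → a ∈ Pair a b
  ∈-Pairˡ {a} = x∈p∪q⁺ (inj₁ (x∈⁅x⁆ a))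

  ∈-Pairʳ : ∀ {a b : Fin m} → b ∈ Pair a b
  ∈-Pairʳ {b = b} = x∈p∪q⁺ (inj₂ (x∈⁅x⁆ b))

  ∉-Pair : ∀ {a b e : Fin m} → e ≢ a → e ≢ b → e ∉ Pair a b
  ∉-Pair e≢a e≢b e∈ = [ e≢a , e≢b ] (∈-Pair⁻ e∈)

  Pair⊆ : ∀ {a b : Fin m} {p : Subset m} → a ∈ p → b ∈ p → Pair a b ⊆ p
  Pair⊆ a∈p b∈p e∈ with ∈-Pair⁻ e∈
  ... | inj₁ refl = a∈p
  ... | inj₂ refl = b∈p

  ∣Pair∣≥2 : ∀ {a b : Fin m} → a ≢ b → 2 ≤ ∣ Pair a b ∣
  ∣Pair∣≥2 = distinct⇒2≤∣p∣ ∈-Pairˡ ∈-Pairʳ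

  ∈-Triple⁻ : ∀ {a b c e : Fin m} → e ∈ Triple a b c → e ≡ a ⊎ e ≡ b ⊎ e ≡ c
  ∈-Triple⁻ {a} e∈ with x∈p∪q⁻ _ _ e∈
  ... | inj₁ e∈a  = inj₁ (x∈⁅y⁆⇒x≡y a e∈a)
  ... | inj₂ e∈bc = inj₂ (∈-Pair⁻ e∈bc)

  ∈-Tripleᵃ : ∀ {a b c : Fin m} → a ∈ Triple a b c
  ∈-Tripleᵃ {a} = x∈p∪q⁺ (inj₁ (x∈⁅x⁆ a))

  ∈-Tripleᵇ : ∀ {a b c : Fin m} → b ∈ Triple a b c
  ∈-Tripleᵇ = x∈p∪q⁺ (inj₂ ∈-Pairˡ)

  ∈-Tripleᶜ : ∀ {a b c : Fin m} → c ∈ Triple a b c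
  ∈-Tripleᶜ = x∈p∪q⁺ (inj₂ ∈-Pairʳ)

  exactlyTwo-∈-Pair : ∀ {a b c e : Fin m} → Distinct3 a b c → e ∈ Triple a b c →
                      ExactlyTwo (e ∈ Pair b c) (e ∈ Pair a c) (e ∈ Pair a b)
  exactlyTwo-∈-Pair (a≢b , a≢c , b≢c) e∈ with ∈-Triple⁻ e∈
  ... | inj₁ refl        = inj₂ (inj₂ (∉-Pair a≢b a≢c , ∈-Pairˡ , ∈-Pairˡ))
  ... | inj₂ (inj₁ refl) = inj₂ (inj₁ (∈-Pairˡ , ∉-Pair (a≢b ∘ sym) b≢c , ∈-Pairʳ))
  ... | inj₂ (inj₂ refl) = inj₁ (∈-Pairʳ , ∈-Pairʳ , ∉-Pair (a≢c ∘ sym) (b≢c ∘ sym))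

ExactlyTwo-resp-⇔ : ∀ {P P′ Q Q′ R R′ : Set} → P ⇔ P′ → Q ⇔ Q′ → R ⇔ R′ →
                    ExactlyTwo P Q R → ExactlyTwo P′ Q′ R′
ExactlyTwo-resp-⇔ P⇔ Q⇔ R⇔ (inj₁ (p , q , ¬r)) =
  inj₁ (to P⇔ p , to Q⇔ q , ¬r ∘ from R⇔)
ExactlyTwo-resp-⇔ P⇔ Q⇔ R⇔ (inj₂ (inj₁ (p , ¬q , r))) =
  inj₂ (inj₁ (to P⇔ p , ¬q ∘ from Q⇔ , to R⇔ r))
ExactlyTwo-resp-⇔ P⇔ Q⇔ R⇔ (inj₂ (inj₂ (¬p , q , r))) =
  inj₂ (inj₂ (¬p ∘ from P⇔ , to Q⇔ q , to R⇔ r))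

module _ (H : Hereditary23) where
  open Hereditary23 H

  ∣U∣≤3 : ∀ v → ∣ U v ∣ ≤ 3
  ∣U∣≤3 v with size23 v
  ... | inj₁ ∣U∣≡2 rewrite ∣U∣≡2 = s≤s (s≤s z≤n)
  ... | inj₂ ∣U∣≡3 rewrite ∣U∣≡3 = s≤s (s≤s (s≤s z≤n))

  IsClaw⇒d≤∣U∣ : ∀ {d c T} → IsClaw H d c T → d ≤ ∣ U c ∣
  IsClaw⇒d≤∣U∣ {d} {c} {T} (T-inj , independent , c-adj) =
    injection⇒≤∣p∣ shared shared-inj (proj₁ ∘ shared∈)
    where
      shared : Fin d → Fin m
      shared i = proj₁ (proj₂ (c-adj i))

      shared∈ : ∀ i → shared i ∈ U c × shared i ∈ U (T i)
      shared∈ i = x∈p∩q⁻ (U c) (U (T i)) (proj₂ (proj₂ (c-adj i)))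

      shared-inj : Injective _≡_ _≡_ shared
      shared-inj {i} {j} eq with i ≟ j
      ... | yes i≡j = i≡j
      ... | no  i≢j = ⊥-elim (independent i j
              (i≢j ∘ T-inj i j , shared i ,
               x∈p∩q⁺ (proj₂ (shared∈ i) , subst (_∈ U (T j)) (sym eq) (proj₂ (shared∈ j)))))

  no-4-claw : ∀ c T → ¬ IsClaw H 4 c T
  no-4-claw c T claw = <-irrefl refl (≤-trans (IsClaw⇒d≤∣U∣ claw) (∣U∣≤3 c))

  3-claw⇒w≡2 : ∀ c T → IsClaw H 3 c T → w H c ≡ 2
  3-claw⇒w≡2 c T claw with size23 c
  ... | inj₁ ∣U∣≡2 = ⊥-elim (<-irrefl refl (subst (3 ≤_) ∣U∣≡2 (IsClaw⇒d≤∣U∣ claw)))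
  ... | inj₂ ∣U∣≡3 = cong (_∸ 1) ∣U∣≡3

  Adj-monoʳ : ∀ {x y v} → x ≢ v → U y ⊆ U v → Adj H x y → Adj H x v
  Adj-monoʳ x≢v Uy⊆Uv (_ , e , e∈xy) with x∈p∩q⁻ _ _ e∈xy
  ... | e∈x , e∈y = x≢v , e , x∈p∩q⁺ (e∈x , Uy⊆Uv e∈y)

  IsK4⇒⊆ : ∀ {v a b c va vb vc} → IsK4 H v a b c va vb vc →
           U va ⊆ U v × U vb ⊆ U v × U vc ⊆ U v
  IsK4⇒⊆ (_ , ev , ea , eb , ec) rewrite ev | ea | eb | ec =
    Pair⊆ ∈-Tripleᵇ ∈-Tripleᶜ , Pair⊆ ∈-Tripleᵃ ∈-Tripleᶜ , Pair⊆ ∈-Tripleᵃ ∈-Tripleᵇ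

  K4-neighbour⇒Adj : ∀ {v a b c va vb vc} → IsK4 H v a b c va vb vc →
                     ∀ x → x ≢ v → (Adj H x v ⊎ Adj H x va ⊎ Adj H x vb ⊎ Adj H x vc) → Adj H x v
  K4-neighbour⇒Adj K4 x x≢v (inj₁ x~v)               = x~v
  K4-neighbour⇒Adj K4 x x≢v (inj₂ (inj₁ x~va))        = Adj-monoʳ x≢v (proj₁ (IsK4⇒⊆ K4)) x~va
  K4-neighbour⇒Adj K4 x x≢v (inj₂ (inj₂ (inj₁ x~vb))) = Adj-monoʳ x≢v (proj₁ (proj₂ (IsK4⇒⊆ K4))) x~vb
  K4-neighbour⇒Adj K4 x x≢v (inj₂ (inj₂ (inj₂ x~vc))) = Adj-monoʳ x≢v (proj₂ (proj₂ (IsK4⇒⊆ K4))) x~vc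

  single-neighbour-≢ : ∀ {u v y} → edges H u v ≡ 1 → U y ⊆ U v → 2 ≤ ∣ U y ∣ → u ≢ y
  single-neighbour-≢ {u} {v} single Uu⊆Uv 2≤∣Uu∣ refl =
    <-irrefl refl (≤-trans 2≤∣Uu∣ (subst (∣ U u ∣ ≤_) single (p⊆q⇒∣p∣≤∣q∣ Uu⊆Uu∩Uv)))
    where Uu⊆Uu∩Uv : U u ⊆ U u ∩ U v
          Uu⊆Uu∩Uv e∈u = x∈p∩q⁺ (e∈u , Uu⊆Uv e∈u)

  shared∈⇔Adj : ∀ {u v e y} → edges H u v ≡ 1 → e ∈ U u ∩ U v →
                U y ⊆ U v → 2 ≤ ∣ U y ∣ → e ∈ U y ⇔ Adj H u y
  shared∈⇔Adj {u} {v} {e} {y} single e∈uv Uy⊆Uv 2≤∣Uy∣ = mk⇔ adjacent shares-e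
    where
      adjacent : e ∈ U y → Adj H u y
      adjacent e∈y = single-neighbour-≢ single Uy⊆Uv 2≤∣Uy∣ , e ,
                     x∈p∩q⁺ (proj₁ (x∈p∩q⁻ (U u) (U v) e∈uv) , e∈y)

      shares-e : Adj H u y → e ∈ U y
      shares-e (_ , f , f∈uy) with x∈p∩q⁻ (U u) (U y) f∈uy
      ... | f∈u , f∈y =
        subst (_∈ U y) (∣p∣≡1⇒unique single (x∈p∩q⁺ (f∈u , Uy⊆Uv f∈y)) e∈uv) f∈y

  single-neighbour⇒exactlyTwo : ∀ {v a b c va vb vc} → IsK4 H v a b c va vb vc →
                                ∀ u → SingleNeighbors H u v →
                                ExactlyTwo (Adj H u va) (Adj H u vb) (Adj H u vc)
  single-neighbour⇒exactlyTwo {v} K4@(distinct , ev , ea , eb , ec) u ((_ , e , e∈uv) , single)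
    with IsK4⇒⊆ K4 | distinct
  ... | Uva⊆Uv , Uvb⊆Uv , Uvc⊆Uv | a≢b , a≢c , b≢c =
    ExactlyTwo-resp-⇔ (via ea b≢c Uva⊆Uv) (via eb a≢c Uvb⊆Uv) (via ec a≢b Uvc⊆Uv)
                      (exactlyTwo-∈-Pair distinct (subst (e ∈_) ev (proj₂ (x∈p∩q⁻ _ _ e∈uv))))
    where
      via : ∀ {y p q} → U y ≡ Pair p q → p ≢ q → U y ⊆ U v → e ∈ Pair p q ⇔ Adj H u y
      via Uy≡pq p≢q Uy⊆Uv =
        ⇔.trans (mk⇔ (subst (e ∈_) (sym Uy≡pq)) (subst (e ∈_) Uy≡pq))
                (shared∈⇔Adj single e∈uv Uy⊆Uv (subst (2 ≤_) (cong ∣_∣ (sym Uy≡pq)) (∣Pair∣≥2 p≢q)))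

proposition2 : (H : Hereditary23) →
    ((c : Fin (Hereditary23.n H)) (T : Fin 4 → Fin (Hereditary23.n H)) → ¬ IsClaw H 4 c T)
    × ((c : Fin (Hereditary23.n H)) (T : Fin 3 → Fin (Hereditary23.n H)) → IsClaw H 3 c T → w H c ≡ 2)
    × (∀ v a b c va vb vc → w H v ≡ 2 → IsK4 H v a b c va vb vc →
    ∀ x → x ≢ v → (Adj H x v ⊎ Adj H x va ⊎ Adj H x vb ⊎ Adj H x vc) → Adj H x v)
    × (∀ v a b c va vb vc → w H v ≡ 2 → IsK4 H v a b c va vb vc →
    ∀ u → SingleNeighbors H u v → ExactlyTwo (Adj H u va) (Adj H u vb) (Adj H u vc))
-- The weight hypotheses of (ii) and (iii) are implied by IsK4, which fixes U v as a triple.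
proposition2 H =
    no-4-claw H
  , 3-claw⇒w≡2 H
  , (λ v a b c va vb vc _ → K4-neighbour⇒Adj H)
  , (λ v a b c va vb vc _ → single-neighbour⇒exactlyTwo H)
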